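{- Let $p\ge5$ be a prime. There exists $\alpha\in\mu_{p-1}\setminus\{\pm1\}$ such that $$\sum_{k=1}^{p-1}(-1)^k\frac{\binom pk}{p}\,\omega(k)\,\alpha^k\not\equiv0\pmod{p^2}.$$
   Context: $\mu_{p-1}\subset\mathbb Z_p^\times$ is the group of $(p-1)$-th roots of unity and $\omega(k)$ denotes the Teichmüller lift of $k$, i.e. the unique element of $\mu_{p-1}$ congruent to $k$ modulo $p$. Congruences are in $\mathbb Z_p$. -}

module Defs where

open import Data.Nat as ℕ using (ℕ; zero; suc)
open import Data.Nat.Primality using (Prime; prime⇒nonZero)
open import Data.Nat.Combinatorics using (_C_)
open import Data.Nat.DivMod using (_/_)
open import Data.Integer using (ℤ; +_; _-_; _+_; _*_; _^_; 0ℤ; 1ℤ; -1ℤ)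
open import Data.Integer.Divisibility using (_∣_)

_≡_[mod_] : ℤ → ℤ → ℕ → Set
a ≡ b [mod m ] = (+ m) ∣ (a - b)

sumFrom1 : ℕ → (ℕ → ℤ) → ℤ
sumFrom1 zero    f = 0ℤ
sumFrom1 (suc n) f = sumFrom1 n f + f (suc n)

-- binom(p,k)/p (an integer for 1 ≤ k ≤ p-1 when p is prime)
binomOverP : (p : ℕ) → Prime p → ℕ → ℕ
binomOverP p pr k = _/_ (p C k) p {{prime⇒nonZero pr}}

-- x (mod p²) is the reduction of an element of μ_{p-1} ⊂ ℤ_p,
-- i.e. x^{p-1} ≡ 1 (mod p²)
InMuModP² : ℕ → ℤ → Set
InMuModP² p x = (x ^ (p ℕ.∸ 1)) ≡ 1ℤ [mod (p ℕ.* p) ]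

-- w agrees modulo p² with the Teichmüller lift on k = 1,…,p-1:
-- w k ∈ μ_{p-1} (mod p²) and w k ≡ k (mod p)
IsTeichmüllerModP² : ℕ → (ℕ → ℤ) → Set
IsTeichmüllerModP² p w =
  ∀ k → 1 ℕ.≤ k → k ℕ.< p → InMuModP² p (w k) × (w k ≡ + k [mod p ])
  where open import Data.Product using (_×_)

theSum : (p : ℕ) → Prime p → (ℕ → ℤ) → ℤ → ℤ
theSum p pr ω α =
  sumFrom1 (p ℕ.∸ 1) (λ k → (-1ℤ ^ k) * (+ binomOverP p pr k) * ω k * (α ^ k))

{-# OPTIONS --safe #-}
module Submission where

-- Write p = n + 1 and let c k = (-1)^k (C(p,k)/p) k^p be the coefficients of the sum for the
-- Teichmüller representatives k^p. Since k C(p,k)/p = C(n,k-1) ≡ (-1)^(k-1) (mod p), every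
-- c k ≡ -1, so the coefficients u k = 1 + c k of U(x) = Σ u k x^k are divisible by p. For
-- α = a^p with 2 ≤ a ≤ p-2 the geometric sum Σ α^k vanishes modulo p², hence the sum equals
-- U(a) modulo p². As p divides the u k, the values of U modulo p² determine its coefficients
-- through power sums modulo p: Σ_a a^(n-k) U(a) ≡ -u k (mod p²). So if the sum vanished for
-- every such a, only a = 1 and a = p-1 ≡ -1 would contribute, and u k ≡ -(U(1) + U(p-1)) for
-- every even k. Now u n ≡ 0 (mod p²), since n^p ≡ (-1)^p modulo p², so u 2 ≡ u 4 ≡ 0; but
-- writing 2^p = 2 + t p one computes 24 u 4 - 48 u 2 ≡ -4p (mod p²), and p ∤ 4.

open import Defs
open import Data.Nat using (ℕ; _≤_)
open import Data.Nat as ℕ using ()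
open import Data.Nat.Primality using (Prime)
open import Data.Integer using (ℤ; 0ℤ; 1ℤ; -1ℤ)
open import Data.Product using (Σ; _×_)
open import Relation.Nullary using (¬_)

open import Data.Integer using (+_; -_; _+_; _-_; _*_; _^_; ∣_∣)
import Data.Integer.Divisibility.Signed as ℤ
import Data.Integer.Properties as ℤ
open import Data.Integer.Tactic.RingSolver using (solve-∀)
open import Data.Nat using (zero; suc; _<_; z≤n; s≤s)
open import Data.Nat.Combinatorics
  using (_C_; nCk+nC[k+1]≡[n+1]C[k+1]; nCk≡nC[n∸k]; k>n⇒nCk≡0; nCn≡1; nC1≡n)
import Data.Nat.Divisibility as ℕ
import Data.Nat.DivMod as ℕ
open import Data.Nat.Induction using (<-rec)
open import Data.Nat.Primality using (euclidsLemma; prime⇒nonZero; prime⇒¬composite; composite)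
import Data.Nat.Properties as ℕ
import Data.Nat.Tactic.RingSolver as ℕ-Solver
open import Algebra.Properties.CommutativeSemigroup ℕ.*-commutativeSemigroup using (x∙yz≈y∙xz)
open import Data.Product using (_,_; proj₁; proj₂)
open import Data.Sum as Sum using (_⊎_; inj₁; inj₂; [_,_]′)
open import Function using (_∘_)
open import Level using (0ℓ)
open import Relation.Binary.Bundles using (Setoid)
open import Relation.Binary.Definitions using (tri<; tri≈; tri>)
open import Relation.Binary.PropositionalEquality
  using (_≡_; _≢_; refl; sym; trans; cong; cong₂; subst; module ≡-Reasoning)
import Relation.Binary.Reasoning.Setoid as SetoidReasoning
open import Relation.Nullary using (Dec; yes; no; contradiction)
open import Relation.Nullary.Decidable using (map′; ¬?; _×-dec_; decidable-stable)

private
  variable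
    j k m : ℕ
    a b c d x y : ℤ
    f g : ℕ → ℤ

-- _≡_[mod_] unfolds to a divisibility of absolute values, from which Agda cannot recover
-- the two sides; this record wrapper keeps them inferable.
infix 4 _≈_[mod_]
record _≈_[mod_] (a b : ℤ) (m : ℕ) : Set where
  constructor ≈mod
  field ≡mod : a ≡ b [mod m ]
open _≈_[mod_] public

private
  signed : a ≈ b [mod m ] → + m ℤ.∣ a - b
  signed = ℤ.∣ᵤ⇒∣ ∘ ≡mod

  via : a - b ≡ c → + m ℤ.∣ c → a ≈ b [mod m ]
  via eq m∣c = ≈mod (ℤ.∣⇒∣ᵤ (subst (_ ℤ.∣_) (sym eq) m∣c))

  ≈0⇒∣ : x ≈ 0ℤ [mod m ] → m ℕ.∣ ∣ x ∣
  ≈0⇒∣ {x} (≈mod m∣x) = subst (λ z → _ ℕ.∣ ∣ z ∣) (ℤ.+-identityʳ x) m∣x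

  ∣⇒≈0 : ∀ {x} → m ℕ.∣ ∣ x ∣ → x ≈ 0ℤ [mod m ]
  ∣⇒≈0 {x = x} m∣x = ≈mod (subst (λ z → _ ℕ.∣ ∣ z ∣) (sym (ℤ.+-identityʳ x)) m∣x)

≡⇒≈[mod] : a ≡ b → a ≈ b [mod m ]
≡⇒≈[mod] {a} refl = via (ℤ.+-inverseʳ a) (ℤ.divides 0ℤ refl)

mod-refl : a ≈ a [mod m ]
mod-refl = ≡⇒≈[mod] refl

mod-sym : a ≈ b [mod m ] → b ≈ a [mod m ]
mod-sym {a = a} {b = b} a≈b = via (lemma a b) (ℤ.∣m⇒∣-m (signed a≈b))
  where
  lemma : ∀ a b → b - a ≡ - (a - b)
  lemma = solve-∀

mod-trans : a ≈ b [mod m ] → b ≈ c [mod m ] → a ≈ c [mod m ]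
mod-trans {a = a} {b = b} {c = c} a≈b b≈c = via (lemma a b c) (ℤ.∣m∣n⇒∣m+n (signed a≈b) (signed b≈c))
  where
  lemma : ∀ a b c → a - c ≡ (a - b) + (b - c)
  lemma = solve-∀

+-cong-mod : a ≈ b [mod m ] → c ≈ d [mod m ] → a + c ≈ b + d [mod m ]
+-cong-mod {a = a} {b = b} {c = c} {d = d} a≈b c≈d =
  via (lemma a b c d) (ℤ.∣m∣n⇒∣m+n (signed a≈b) (signed c≈d))
  where
  lemma : ∀ a b c d → (a + c) - (b + d) ≡ (a - b) + (c - d)
  lemma = solve-∀

-‿cong-mod : a ≈ b [mod m ] → - a ≈ - b [mod m ]
-‿cong-mod {a = a} {b = b} a≈b = via (lemma a b) (ℤ.∣m⇒∣-m (signed a≈b))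
  where
  lemma : ∀ a b → - a - - b ≡ - (a - b)
  lemma = solve-∀

*-cong-mod : a ≈ b [mod m ] → c ≈ d [mod m ] → a * c ≈ b * d [mod m ]
*-cong-mod {a = a} {b = b} {c = c} {d = d} a≈b c≈d =
  via (lemma a b c d) (ℤ.∣m∣n⇒∣m+n (ℤ.∣n⇒∣m*n a (signed c≈d)) (ℤ.∣n⇒∣m*n d (signed a≈b)))
  where
  lemma : ∀ a b c d → a * c - b * d ≡ a * (c - d) + d * (a - b)
  lemma = solve-∀

+-congˡ-mod : ∀ a → b ≈ c [mod m ] → a + b ≈ a + c [mod m ]
+-congˡ-mod a = +-cong-mod (mod-refl {a = a})

+-congʳ-mod : ∀ a → b ≈ c [mod m ] → b + a ≈ c + a [mod m ]
+-congʳ-mod a b≈c = +-cong-mod b≈c (mod-refl {a = a})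

*-congˡ-mod : ∀ a → b ≈ c [mod m ] → a * b ≈ a * c [mod m ]
*-congˡ-mod a = *-cong-mod (mod-refl {a = a})

*-congʳ-mod : ∀ a → b ≈ c [mod m ] → b * a ≈ c * a [mod m ]
*-congʳ-mod a b≈c = *-cong-mod b≈c (mod-refl {a = a})

^-cong-mod : a ≈ b [mod m ] → ∀ k → a ^ k ≈ b ^ k [mod m ]
^-cong-mod a≈b zero    = mod-refl
^-cong-mod a≈b (suc k) = *-cong-mod a≈b (^-cong-mod a≈b k)

mod-setoid : ℕ → Setoid 0ℓ 0ℓ
mod-setoid m = record
  { Carrier       = ℤ
  ; _≈_           = _≈_[mod m ]
  ; isEquivalence = record { refl = mod-refl ; sym = mod-sym ; trans = mod-trans }
  }

module ModReasoning (m : ℕ) = SetoidReasoning (mod-setoid m)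

_≈?_[mod_] : ∀ a b m → Dec (a ≈ b [mod m ])
a ≈? b [mod m ] = map′ ≈mod ≡mod (m ℕ.∣? ∣ a - b ∣)

≈[mod]-witness : a ≈ b [mod m ] → Σ ℤ λ t → a ≡ b + t * + m
≈[mod]-witness {a} {b} a≈b with signed a≈b
... | ℤ.divides t a-b≡t*m = t , trans (lemma a b) (cong (λ s → b + s) a-b≡t*m)
  where
  lemma : ∀ a b → a ≡ b + (a - b)
  lemma = solve-∀

≈⇒-≈0 : a ≈ b [mod m ] → a - b ≈ 0ℤ [mod m ]
≈⇒-≈0 {b = b} a≈b = mod-trans (+-congʳ-mod (- b) a≈b) (≡⇒≈[mod] (ℤ.+-inverseʳ b))

-≈0⇒≈ : a - b ≈ 0ℤ [mod m ] → a ≈ b [mod m ]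
-≈0⇒≈ {a} {b} a-b≈0 =
  mod-trans (≡⇒≈[mod] (lemma a b)) (mod-trans (+-congʳ-mod b a-b≈0) (≡⇒≈[mod] (ℤ.+-identityˡ b)))
  where
  lemma : ∀ a b → a ≡ (a - b) + b
  lemma = solve-∀

modulus≈0 : ∀ {n} → + n ≈ 0ℤ [mod n ]
modulus≈0 {n} = ∣⇒≈0 (ℕ.∣-refl {n})

pred≈-1 : ∀ {n} → + n ≈ -1ℤ [mod suc n ]
pred≈-1 {n} = ≈mod (ℕ.∣-reflexive (ℕ.+-comm 1 n))

*-zeroˡ-mod : ∀ b → a ≈ 0ℤ [mod m ] → a * b ≈ 0ℤ [mod m ]
*-zeroˡ-mod b a≈0 = mod-trans (*-congʳ-mod b a≈0) (≡⇒≈[mod] (ℤ.*-zeroˡ b))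

small≉0 : 1 ≤ k → k < m → ¬ (+ k ≈ 0ℤ [mod m ])
small≉0 {suc k} _ k<m m∣k = ℕ.<⇒≱ k<m (ℕ.∣⇒≤ (≈0⇒∣ m∣k))

small≉1 : 2 ≤ k → k < m → ¬ (+ k ≈ 1ℤ [mod m ])
small≉1 {suc k} (s≤s 1≤k) 1+k<m k≈1 = small≉0 1≤k (ℕ.<-trans (ℕ.n<1+n k) 1+k<m) (≈⇒-≈0 k≈1)

small≉-1 : suc k < m → ¬ (+ k ≈ -1ℤ [mod m ])
small≉-1 {k} {m} 1+k<m k≈-1 =
  small≉0 (ℕ.m≤n+m 1 k) (subst (_< m) (ℕ.+-comm 1 k) 1+k<m) (≈⇒-≈0 k≈-1)

mod-square⇒mod : a ≈ b [mod m ℕ.* m ] → a ≈ b [mod m ]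
mod-square⇒mod {m = m} (≈mod m²∣a-b) = ≈mod (ℕ.∣-trans (ℕ.m∣m*n m) m²∣a-b)

*-cong-mod-square : a ≈ 0ℤ [mod m ] → x ≈ y [mod m ] → a * x ≈ a * y [mod m ℕ.* m ]
*-cong-mod-square {a} {m} {x} {y} a≈0 (≈mod m∣x-y) =
  -≈0⇒≈ (∣⇒≈0 (subst (λ z → _ ℕ.∣ ∣ z ∣) (lemma a x y) m²∣a[x-y]))
  where
  lemma : ∀ a x y → a * (x - y) ≡ a * x - a * y
  lemma = solve-∀
  m²∣a[x-y] : m ℕ.* m ℕ.∣ ∣ a * (x - y) ∣
  m²∣a[x-y] = subst (_ ℕ.∣_) (sym (ℤ.abs-* a (x - y))) (ℕ.*-pres-∣ (≈0⇒∣ a≈0) m∣x-y)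

prime-euclid-mod : ∀ {p} → Prime p → a * b ≈ 0ℤ [mod p ] → a ≈ 0ℤ [mod p ] ⊎ b ≈ 0ℤ [mod p ]
prime-euclid-mod {a = a} {b = b} pr ab≈0 =
  Sum.map ∣⇒≈0 ∣⇒≈0 (euclidsLemma ∣ a ∣ ∣ b ∣ pr (subst (_ ℕ.∣_) (ℤ.abs-* a b) (≈0⇒∣ ab≈0)))

prime-*-cancelˡ-mod : ∀ {p} → Prime p → ¬ (a ≈ 0ℤ [mod p ]) → a * x ≈ a * y [mod p ] → x ≈ y [mod p ]
prime-*-cancelˡ-mod {a = a} {x = x} {y = y} pr a≉0 ax≈ay =
  [ (λ a≈0 → contradiction a≈0 a≉0) , -≈0⇒≈ ]′ (prime-euclid-mod pr a[x-y]≈0)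
  where
  lemma : ∀ a x y → a * (x - y) ≡ a * x - a * y
  lemma = solve-∀
  a[x-y]≈0 : a * (x - y) ≈ 0ℤ [mod _ ]
  a[x-y]≈0 = mod-trans (≡⇒≈[mod] (lemma a x y)) (≈⇒-≈0 ax≈ay)

prime-*-cancelˡ-mod-square : ∀ {p} → Prime p → ¬ (a ≈ 0ℤ [mod p ]) →
                             a * x ≈ 0ℤ [mod p ℕ.* p ] → x ≈ 0ℤ [mod p ℕ.* p ]
prime-*-cancelˡ-mod-square {a = a} {x = x} {p = p} pr a≉0 ax≈0 =
  ∣⇒≈0 (cancel (a≉0 ∘ ∣⇒≈0) (subst (_ ℕ.∣_) (ℤ.abs-* a x) (≈0⇒∣ ax≈0)))
  where
  instance _ = prime⇒nonZero pr
  cancel : ∀ {a x} → ¬ p ℕ.∣ a → p ℕ.* p ℕ.∣ a ℕ.* x → p ℕ.* p ℕ.∣ x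
  cancel {a} {x} p∤a p²∣ax with euclidsLemma a x pr (ℕ.∣-trans (ℕ.m∣m*n p) p²∣ax)
  ... | inj₁ p∣a = contradiction p∣a p∤a
  ... | inj₂ (ℕ.divides-refl q) with euclidsLemma a q pr (ℕ.*-cancelʳ-∣ p p²∣aqp)
    where
    p²∣aqp : p ℕ.* p ℕ.∣ a ℕ.* q ℕ.* p
    p²∣aqp = subst (p ℕ.* p ℕ.∣_) (sym (ℕ.*-assoc a q p)) p²∣ax
  ...   | inj₁ p∣a = contradiction p∣a p∤a
  ...   | inj₂ p∣q = ℕ.*-monoˡ-∣ p p∣q

-1^even : ∀ h → -1ℤ ^ (2 ℕ.* h) ≡ 1ℤ
-1^even h = trans (sym (ℤ.^-*-assoc -1ℤ 2 h)) (ℤ.^-zeroˡ h)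

-1^j*-1^j≡1 : ∀ j → -1ℤ ^ j * -1ℤ ^ j ≡ 1ℤ
-1^j*-1^j≡1 j = begin
  -1ℤ ^ j * -1ℤ ^ j       ≡⟨ ℤ.^-distribˡ-+-* -1ℤ j j ⟨
  -1ℤ ^ (j ℕ.+ j)         ≡⟨ cong (λ i → -1ℤ ^ (j ℕ.+ i)) (ℕ.+-identityʳ j) ⟨
  -1ℤ ^ (2 ℕ.* j)         ≡⟨ -1^even j ⟩
  1ℤ                      ∎
  where open ≡-Reasoning

sumFrom1-cong : ∀ n → (∀ i → f i ≡ g i) → sumFrom1 n f ≡ sumFrom1 n g
sumFrom1-cong zero    f≗g = refl
sumFrom1-cong (suc n) f≗g = cong₂ _+_ (sumFrom1-cong n f≗g) (f≗g (suc n))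

sumFrom1-cong-mod : ∀ n → (∀ i → 1 ≤ i → i ≤ n → f i ≈ g i [mod m ]) →
                    sumFrom1 n f ≈ sumFrom1 n g [mod m ]
sumFrom1-cong-mod zero    f≈g = mod-refl
sumFrom1-cong-mod (suc n) f≈g =
  +-cong-mod (sumFrom1-cong-mod n (λ i 1≤i i≤n → f≈g i 1≤i (ℕ.m≤n⇒m≤1+n i≤n)))
             (f≈g (suc n) (s≤s z≤n) ℕ.≤-refl)

sumFrom1-zero-mod : ∀ n → (∀ i → 1 ≤ i → i ≤ n → f i ≈ 0ℤ [mod m ]) → sumFrom1 n f ≈ 0ℤ [mod m ]
sumFrom1-zero-mod zero    f≈0 = mod-refl
sumFrom1-zero-mod (suc n) f≈0 =
  +-cong-mod (sumFrom1-zero-mod n (λ i 1≤i i≤n → f≈0 i 1≤i (ℕ.m≤n⇒m≤1+n i≤n)))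
             (f≈0 (suc n) (s≤s z≤n) ℕ.≤-refl)

sumFrom1-+ : ∀ n f g → sumFrom1 n (λ i → f i + g i) ≡ sumFrom1 n f + sumFrom1 n g
sumFrom1-+ zero    f g = refl
sumFrom1-+ (suc n) f g =
  trans (cong (_+ (f (suc n) + g (suc n))) (sumFrom1-+ n f g))
        (lemma (sumFrom1 n f) (sumFrom1 n g) (f (suc n)) (g (suc n)))
  where
  lemma : ∀ a b c d → a + b + (c + d) ≡ a + c + (b + d)
  lemma = solve-∀

sumFrom1-*ˡ : ∀ n a f → sumFrom1 n (λ i → a * f i) ≡ a * sumFrom1 n f
sumFrom1-*ˡ zero    a f = sym (ℤ.*-zeroʳ a)
sumFrom1-*ˡ (suc n) a f =
  trans (cong (_+ a * f (suc n)) (sumFrom1-*ˡ n a f)) (sym (ℤ.*-distribˡ-+ a _ _))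

sumFrom1-const : ∀ n a → sumFrom1 n (λ _ → a) ≡ + n * a
sumFrom1-const zero    a = refl
sumFrom1-const (suc n) a = trans (cong (_+ a) (sumFrom1-const n a)) (lemma (+ n) a)
  where
  lemma : ∀ n a → n * a + a ≡ (1ℤ + n) * a
  lemma = solve-∀

sumFrom1-swap : ∀ n k (h : ℕ → ℕ → ℤ) →
                sumFrom1 n (λ i → sumFrom1 k (h i)) ≡ sumFrom1 k (λ j → sumFrom1 n (λ i → h i j))
sumFrom1-swap zero    k h = sym (trans (sumFrom1-const k 0ℤ) (ℤ.*-zeroʳ (+ k)))
sumFrom1-swap (suc n) k h =
  trans (cong (_+ sumFrom1 k (h (suc n))) (sumFrom1-swap n k h))
        (sym (sumFrom1-+ k (λ j → sumFrom1 n (λ i → h i j)) (h (suc n))))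

sumFrom1-suc : ∀ n (f : ℕ → ℤ) → sumFrom1 (suc n) f ≡ f 1 + sumFrom1 n (λ i → f (suc i))
sumFrom1-suc zero    f = ℤ.+-comm 0ℤ (f 1)
sumFrom1-suc (suc n) f =
  trans (cong (_+ f (suc (suc n))) (sumFrom1-suc n f)) (ℤ.+-assoc (f 1) _ _)

sumFrom1-telescope : ∀ n (f : ℕ → ℤ) → sumFrom1 n (λ i → f (suc i) - f i) ≡ f (suc n) - f 1
sumFrom1-telescope zero    f = sym (ℤ.+-inverseʳ (f 1))
sumFrom1-telescope (suc n) f =
  trans (cong (_+ (f (suc (suc n)) - f (suc n))) (sumFrom1-telescope n f))
        (lemma (f (suc n)) (f 1) (f (suc (suc n))))
  where
  lemma : ∀ a b c → a - b + (c - a) ≡ c - b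
  lemma = solve-∀

sumFrom1-single-mod : ∀ n → 1 ≤ k → k ≤ n → (∀ i → 1 ≤ i → i ≤ n → i ≢ k → f i ≈ 0ℤ [mod m ]) →
                      sumFrom1 n f ≈ f k [mod m ]
sumFrom1-single-mod zero (s≤s _) ()
sumFrom1-single-mod {k = k} {f = f} (suc n) 1≤k k≤1+n others with suc n ℕ.≟ k
... | yes refl =
  mod-trans (+-congʳ-mod (f k) (sumFrom1-zero-mod n λ i 1≤i i≤n →
                                  others i 1≤i (ℕ.m≤n⇒m≤1+n i≤n) λ { refl → ℕ.<-irrefl refl (s≤s i≤n) }))
            (≡⇒≈[mod] (ℤ.+-identityˡ (f k)))
... | no 1+n≢k =
  mod-trans (+-cong-mod (sumFrom1-single-mod n 1≤k (ℕ.≤-pred (ℕ.≤∧≢⇒< k≤1+n (1+n≢k ∘ sym)))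
                                             (λ i 1≤i i≤n → others i 1≤i (ℕ.m≤n⇒m≤1+n i≤n)))
                        (others (suc n) (s≤s z≤n) ℕ.≤-refl 1+n≢k))
            (≡⇒≈[mod] (ℤ.+-identityʳ (f k)))

sumFrom1-ends-mod : ∀ n → 2 ≤ n → (∀ i → 2 ≤ i → i < n → f i ≈ 0ℤ [mod m ]) →
                    sumFrom1 n f ≈ f 1 + f n [mod m ]
sumFrom1-ends-mod {f = f} (suc n) (s≤s 1≤n) inner =
  +-congʳ-mod (f (suc n)) (sumFrom1-single-mod n ℕ.≤-refl 1≤n λ i 1≤i i≤n i≢1 →
                             inner i (ℕ.≤∧≢⇒< 1≤i (i≢1 ∘ sym)) (s≤s i≤n))

-- Binomial coefficients and Fermat's little theorem

binomial-theorem : ∀ n x → (1ℤ + x) ^ n ≡ 1ℤ + sumFrom1 n (λ i → + (n C i) * x ^ i)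
binomial-theorem zero    x = refl
binomial-theorem (suc n) x = begin
  (1ℤ + x) * (1ℤ + x) ^ n             ≡⟨ cong ((1ℤ + x) *_) (binomial-theorem n x) ⟩
  (1ℤ + x) * (1ℤ + S)                 ≡⟨ lemma₁ x S ⟩
  1ℤ + ((x + S) + x * S)              ≡⟨ cong (λ s → 1ℤ + ((x + s) + x * S)) S≡F1+G ⟩
  1ℤ + ((x + (F 1 + G)) + x * S)      ≡⟨ cong (λ s → 1ℤ + s) (lemma₂ x (F 1) G (x * S)) ⟩
  1ℤ + ((x + F 1) + (x * S + G))      ≡⟨ cong (λ s → 1ℤ + s) T-sum ⟨
  1ℤ + sumFrom1 (suc n) T             ∎
  where
  open ≡-Reasoning
  F T : ℕ → ℤ
  F i = + (n C i) * x ^ i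
  T i = + (suc n C i) * x ^ i
  S G : ℤ
  S = sumFrom1 n F
  G = sumFrom1 n (λ i → F (suc i))

  lemma₁ : ∀ x S → (1ℤ + x) * (1ℤ + S) ≡ 1ℤ + ((x + S) + x * S)
  lemma₁ = solve-∀
  lemma₂ : ∀ x a b c → (x + (a + b)) + c ≡ (x + a) + (c + b)
  lemma₂ = solve-∀
  lemma₃ : ∀ a b x y → (a + b) * (x * y) ≡ x * (a * y) + b * (x * y)
  lemma₃ = solve-∀

  pascal : ∀ i → T (suc i) ≡ x * F i + F (suc i)
  pascal i = begin
    + (suc n C suc i) * x ^ suc i
      ≡⟨ cong (λ c → + c * x ^ suc i) (nCk+nC[k+1]≡[n+1]C[k+1] n i) ⟨
    (+ (n C i) + + (n C suc i)) * (x * x ^ i)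
      ≡⟨ lemma₃ (+ (n C i)) (+ (n C suc i)) x (x ^ i) ⟩
    x * F i + F (suc i)
      ∎

  S≡F1+G : S ≡ F 1 + G
  S≡F1+G = begin
    S                        ≡⟨ ℤ.+-identityʳ S ⟨
    S + 0ℤ                   ≡⟨ cong (λ c → S + + c * x ^ suc n) (k>n⇒nCk≡0 (ℕ.n<1+n n)) ⟨
    sumFrom1 (suc n) F       ≡⟨ sumFrom1-suc n F ⟩
    F 1 + G                  ∎

  T-sum : sumFrom1 (suc n) T ≡ (x + F 1) + (x * S + G)
  T-sum = begin
    sumFrom1 (suc n) T
      ≡⟨ sumFrom1-suc n T ⟩
    T 1 + sumFrom1 n (λ i → T (suc i))
      ≡⟨ cong₂ _+_ (pascal 0) (sumFrom1-cong n pascal) ⟩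
    (x * 1ℤ + F 1) + sumFrom1 n (λ i → x * F i + F (suc i))
      ≡⟨ cong₂ (λ u v → (u + F 1) + v) (ℤ.*-identityʳ x) (sumFrom1-+ n (λ i → x * F i) (λ i → F (suc i))) ⟩
    (x + F 1) + (sumFrom1 n (λ i → x * F i) + G)
      ≡⟨ cong (λ s → (x + F 1) + (s + G)) (sumFrom1-*ˡ n x F) ⟩
    (x + F 1) + (x * S + G)
      ∎

[1+k]*[1+n]C[1+k]≡[1+n]*nCk : ∀ n k → suc k ℕ.* (suc n C suc k) ≡ suc n ℕ.* (n C k)
[1+k]*[1+n]C[1+k]≡[1+n]*nCk zero    zero    = refl
[1+k]*[1+n]C[1+k]≡[1+n]*nCk zero    (suc k) = ℕ.*-zeroʳ (suc (suc k))
[1+k]*[1+n]C[1+k]≡[1+n]*nCk (suc n) zero    =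
  trans (ℕ.+-identityʳ _) (trans (nC1≡n (suc (suc n))) (sym (ℕ.*-identityʳ (suc (suc n)))))
[1+k]*[1+n]C[1+k]≡[1+n]*nCk (suc n) (suc k) = begin
  suc (suc k) ℕ.* (suc (suc n) C suc (suc k))
    ≡⟨ cong (suc (suc k) ℕ.*_) (nCk+nC[k+1]≡[n+1]C[k+1] (suc n) (suc k)) ⟨
  suc (suc k) ℕ.* (A ℕ.+ B)
    ≡⟨ lemma₁ (suc k) A B ⟩
  suc k ℕ.* A ℕ.+ A ℕ.+ suc (suc k) ℕ.* B
    ≡⟨ cong₂ (λ u v → u ℕ.+ A ℕ.+ v) ([1+k]*[1+n]C[1+k]≡[1+n]*nCk n k)
                                     ([1+k]*[1+n]C[1+k]≡[1+n]*nCk n (suc k)) ⟩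
  suc n ℕ.* (n C k) ℕ.+ A ℕ.+ suc n ℕ.* (n C suc k)
    ≡⟨ lemma₂ (suc n) (n C k) (n C suc k) A ⟩
  suc n ℕ.* (n C k ℕ.+ n C suc k) ℕ.+ A
    ≡⟨ cong (λ c → suc n ℕ.* c ℕ.+ A) (nCk+nC[k+1]≡[n+1]C[k+1] n k) ⟩
  suc n ℕ.* A ℕ.+ A
    ≡⟨ ℕ.+-comm (suc n ℕ.* A) A ⟩
  suc (suc n) ℕ.* A
    ∎
  where
  open ≡-Reasoning
  A B : ℕ
  A = suc n C suc k
  B = suc n C suc (suc k)
  lemma₁ : ∀ k a b → suc k ℕ.* (a ℕ.+ b) ≡ k ℕ.* a ℕ.+ a ℕ.+ suc k ℕ.* b
  lemma₁ = ℕ-Solver.solve-∀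
  lemma₂ : ∀ n a b c → n ℕ.* a ℕ.+ c ℕ.+ n ℕ.* b ≡ n ℕ.* (a ℕ.+ b) ℕ.+ c
  lemma₂ = ℕ-Solver.solve-∀

[1+n]Cn≡1+n : ∀ n → suc n C n ≡ suc n
[1+n]Cn≡1+n n =
  trans (nCk≡nC[n∸k] (ℕ.n≤1+n n)) (trans (cong (suc n C_) (ℕ.m+n∸n≡m 1 n)) (nC1≡n (suc n)))

6*[2+m]C3 : ∀ m → 6 ℕ.* (suc (suc m) C 3) ≡ suc (suc m) ℕ.* suc m ℕ.* m
6*[2+m]C3 m = begin
  6 ℕ.* (suc (suc m) C 3)                  ≡⟨ ℕ.*-assoc 2 3 (suc (suc m) C 3) ⟩
  2 ℕ.* (3 ℕ.* (suc (suc m) C 3))          ≡⟨ cong (2 ℕ.*_) ([1+k]*[1+n]C[1+k]≡[1+n]*nCk (suc m) 2) ⟩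
  2 ℕ.* (suc (suc m) ℕ.* (suc m C 2))      ≡⟨ x∙yz≈y∙xz 2 (suc (suc m)) (suc m C 2) ⟩
  suc (suc m) ℕ.* (2 ℕ.* (suc m C 2))      ≡⟨ cong (suc (suc m) ℕ.*_) ([1+k]*[1+n]C[1+k]≡[1+n]*nCk m 1) ⟩
  suc (suc m) ℕ.* (suc m ℕ.* (m C 1))      ≡⟨ cong (λ c → suc (suc m) ℕ.* (suc m ℕ.* c)) (nC1≡n m) ⟩
  suc (suc m) ℕ.* (suc m ℕ.* m)            ≡⟨ ℕ.*-assoc (suc (suc m)) (suc m) m ⟨
  suc (suc m) ℕ.* suc m ℕ.* m              ∎
  where open ≡-Reasoning

prime∣[p]C[k] : ∀ {p} → Prime p → 1 ≤ k → k < p → p ℕ.∣ p C k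
prime∣[p]C[k] {k = suc k} {p = suc n} pr _ k<p
  with euclidsLemma (suc k) (suc n C suc k) pr
         (ℕ.divides (n C k) (trans ([1+k]*[1+n]C[1+k]≡[1+n]*nCk n k) (ℕ.*-comm (suc n) (n C k))))
... | inj₁ p∣k = contradiction (ℕ.∣⇒≤ p∣k) (ℕ.<⇒≱ k<p)
... | inj₂ p∣C = p∣C

[p]C[k]≈0 : ∀ {p} → Prime p → 1 ≤ k → k < p → + (p C k) ≈ 0ℤ [mod p ]
[p]C[k]≈0 pr 1≤k k<p = ∣⇒≈0 (prime∣[p]C[k] pr 1≤k k<p)

fermat : ∀ {p} → Prime p → ∀ a → (+ a) ^ p ≈ + a [mod p ]
fermat {p = suc n}       pr zero    = ≡⇒≈[mod] (ℤ.*-zeroˡ ((+ 0) ^ n))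
fermat {p = p@(suc n)} pr (suc a) = begin
  (1ℤ + + a) ^ p                                ≡⟨ binomial-theorem p (+ a) ⟩
  1ℤ + (sumFrom1 n T + + (p C p) * (+ a) ^ p)  ≈⟨ +-congˡ-mod 1ℤ (+-congʳ-mod _ inner≈0) ⟩
  1ℤ + (0ℤ + + (p C p) * (+ a) ^ p)            ≡⟨ cong (λ c → 1ℤ + (0ℤ + + c * (+ a) ^ p)) (nCn≡1 p) ⟩
  1ℤ + (0ℤ + 1ℤ * (+ a) ^ p)                   ≡⟨ cong (λ s → 1ℤ + s) (lemma ((+ a) ^ p)) ⟩
  1ℤ + (+ a) ^ p                                ≈⟨ +-congˡ-mod 1ℤ (fermat pr a) ⟩
  1ℤ + + a                                      ∎
  where
  open ModReasoning p
  T : ℕ → ℤ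
  T i = + (p C i) * (+ a) ^ i
  lemma : ∀ x → 0ℤ + 1ℤ * x ≡ x
  lemma = solve-∀
  inner≈0 : sumFrom1 n T ≈ 0ℤ [mod p ]
  inner≈0 = sumFrom1-zero-mod n λ i 1≤i i≤n → *-zeroˡ-mod ((+ a) ^ i) ([p]C[k]≈0 pr 1≤i (s≤s i≤n))

fermat-unit : ∀ {n} → Prime (suc n) → ¬ (+ k ≈ 0ℤ [mod suc n ]) → (+ k) ^ n ≈ 1ℤ [mod suc n ]
fermat-unit {k = k} pr k≉0 =
  prime-*-cancelˡ-mod pr k≉0 (mod-trans (fermat pr k) (≡⇒≈[mod] (sym (ℤ.*-identityʳ (+ k)))))

-- Lifting to the square of the modulus

^-suc-expansion-mod-square : x ≈ y [mod m ] → ∀ k →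
                             x ^ suc k ≈ y ^ suc k + + suc k * y ^ k * (x - y) [mod m ℕ.* m ]
^-suc-expansion-mod-square {x} {y} x≈y zero = ≡⇒≈[mod] (lemma x y)
  where
  lemma : ∀ x y → x * 1ℤ ≡ y * 1ℤ + 1ℤ * 1ℤ * (x - y)
  lemma = solve-∀
^-suc-expansion-mod-square {x} {y} {m} x≈y (suc k) = begin
  x * x ^ suc k                              ≈⟨ *-congˡ-mod x (^-suc-expansion-mod-square x≈y k) ⟩
  x * (y ^ suc k + K * y ^ k * (x - y))      ≡⟨ lemma x y (y ^ k) K ⟩
  E + K * y ^ k * ((x - y) * (x - y))        ≈⟨ +-congˡ-mod E (*-congˡ-mod (K * y ^ k) [x-y]²≈0) ⟩
  E + K * y ^ k * ((x - y) * 0ℤ)             ≡⟨ lemma₀ E (K * y ^ k) (x - y) ⟩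
  E                                          ∎
  where
  open ModReasoning (m ℕ.* m)
  K E : ℤ
  K = + suc k
  E = y ^ suc (suc k) + (1ℤ + K) * y ^ suc k * (x - y)
  lemma : ∀ x y Y K → x * (y * Y + K * Y * (x - y)) ≡
                      y * (y * Y) + (1ℤ + K) * (y * Y) * (x - y) + K * Y * ((x - y) * (x - y))
  lemma = solve-∀
  lemma₀ : ∀ e a d → e + a * (d * 0ℤ) ≡ e
  lemma₀ = solve-∀
  [x-y]²≈0 : (x - y) * (x - y) ≈ (x - y) * 0ℤ [mod m ℕ.* m ]
  [x-y]²≈0 = *-cong-mod-square (≈⇒-≈0 x≈y) (≈⇒-≈0 x≈y)

^-cong-mod-square : x ≈ y [mod m ] → x ^ m ≈ y ^ m [mod m ℕ.* m ]
^-cong-mod-square {m = zero}  _ = mod-refl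
^-cong-mod-square {x} {y} {m = suc k} x≈y = begin
  x ^ suc k                                  ≈⟨ ^-suc-expansion-mod-square x≈y k ⟩
  y ^ suc k + (+ suc k * y ^ k) * (x - y)    ≈⟨ +-congˡ-mod (y ^ suc k) (*-cong-mod-square m*y^k≈0 (≈⇒-≈0 x≈y)) ⟩
  y ^ suc k + (+ suc k * y ^ k) * 0ℤ         ≡⟨ lemma (y ^ suc k) (+ suc k * y ^ k) ⟩
  y ^ suc k                                  ∎
  where
  open ModReasoning (suc k ℕ.* suc k)
  lemma : ∀ e a → e + a * 0ℤ ≡ e
  lemma = solve-∀
  m*y^k≈0 : + suc k * y ^ k ≈ 0ℤ [mod suc k ]
  m*y^k≈0 = *-zeroˡ-mod (y ^ k) modulus≈0

root-of-unity-lift : x ^ k ≈ 1ℤ [mod m ] → (x ^ m) ^ k ≈ 1ℤ [mod m ℕ.* m ]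
root-of-unity-lift {x} {k} {m} x^k≈1 = begin
  (x ^ m) ^ k      ≡⟨ ℤ.^-*-assoc x m k ⟩
  x ^ (m ℕ.* k)    ≡⟨ cong (x ^_) (ℕ.*-comm m k) ⟩
  x ^ (k ℕ.* m)    ≡⟨ ℤ.^-*-assoc x k m ⟨
  (x ^ k) ^ m      ≈⟨ ^-cong-mod-square x^k≈1 ⟩
  1ℤ ^ m           ≡⟨ ℤ.^-zeroˡ m ⟩
  1ℤ               ∎
  where open ModReasoning (m ℕ.* m)

root-of-unity-unique : ∀ {n} → x ^ n ≈ 1ℤ [mod suc n ℕ.* suc n ] → y ^ n ≈ 1ℤ [mod suc n ℕ.* suc n ] →
                       x ≈ y [mod suc n ] → x ≈ y [mod suc n ℕ.* suc n ]
root-of-unity-unique {x = x} {y = y} {n = n} x^n≈1 y^n≈1 x≈y = begin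
  x                ≡⟨ ℤ.*-identityʳ x ⟨
  x * 1ℤ           ≈⟨ *-congˡ-mod x x^n≈1 ⟨
  x ^ suc n        ≈⟨ ^-cong-mod-square x≈y ⟩
  y ^ suc n        ≈⟨ *-congˡ-mod y y^n≈1 ⟩
  y * 1ℤ           ≡⟨ ℤ.*-identityʳ y ⟩
  y                ∎
  where open ModReasoning (suc n ℕ.* suc n)

geometric-sum : ∀ n x → (x - 1ℤ) * sumFrom1 n (x ^_) ≡ x * (x ^ n - 1ℤ)
geometric-sum zero    x = lemma₀ x
  where
  lemma₀ : ∀ x → (x - 1ℤ) * 0ℤ ≡ x * (1ℤ - 1ℤ)
  lemma₀ = solve-∀
geometric-sum (suc n) x = begin
  (x - 1ℤ) * (S + x ^ suc n)                   ≡⟨ ℤ.*-distribˡ-+ (x - 1ℤ) S (x ^ suc n) ⟩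
  (x - 1ℤ) * S + (x - 1ℤ) * x ^ suc n          ≡⟨ cong (_+ (x - 1ℤ) * x ^ suc n) (geometric-sum n x) ⟩
  x * (x ^ n - 1ℤ) + (x - 1ℤ) * (x * x ^ n)    ≡⟨ lemma x (x ^ n) ⟩
  x * (x * x ^ n - 1ℤ)                         ∎
  where
  open ≡-Reasoning
  S = sumFrom1 n (x ^_)
  lemma : ∀ x X → x * (X - 1ℤ) + (x - 1ℤ) * (x * X) ≡ x * (x * X - 1ℤ)
  lemma = solve-∀

geometric-sum-vanishes : ∀ {n} → Prime (suc n) →
                         x ^ n ≈ 1ℤ [mod suc n ℕ.* suc n ] → ¬ (x ≈ 1ℤ [mod suc n ]) →
                         sumFrom1 n (x ^_) ≈ 0ℤ [mod suc n ℕ.* suc n ]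
geometric-sum-vanishes {x = x} {n = n} pr x^n≈1 x≉1 =
  prime-*-cancelˡ-mod-square pr (x≉1 ∘ -≈0⇒≈) (begin
    (x - 1ℤ) * sumFrom1 n (x ^_)      ≡⟨ geometric-sum n x ⟩
    x * (x ^ n - 1ℤ)                  ≈⟨ *-congˡ-mod x (≈⇒-≈0 x^n≈1) ⟩
    x * 0ℤ                            ≡⟨ ℤ.*-zeroʳ x ⟩
    0ℤ                                ∎)
  where open ModReasoning (suc n ℕ.* suc n)

-- Power sums modulo a prime

powerSum : ℕ → ℕ → ℤ
powerSum n e = sumFrom1 n (λ a → (+ a) ^ e)

binomial-tail : ∀ m x → sumFrom1 m (λ i → + (suc m C i) * x ^ i) ≡ ((1ℤ + x) ^ suc m - x ^ suc m) + -1ℤ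
binomial-tail m x = begin
  S                                                                ≡⟨ lemma S (x ^ suc m) ⟨
  1ℤ + (S + 1ℤ * x ^ suc m) - x ^ suc m + -1ℤ
    ≡⟨ cong (λ c → 1ℤ + (S + + c * x ^ suc m) - x ^ suc m + -1ℤ) (nCn≡1 (suc m)) ⟨
  1ℤ + sumFrom1 (suc m) (λ i → + (suc m C i) * x ^ i) - x ^ suc m + -1ℤ
    ≡⟨ cong (λ y → y - x ^ suc m + -1ℤ) (binomial-theorem (suc m) x) ⟨
  (1ℤ + x) ^ suc m - x ^ suc m + -1ℤ                               ∎
  where
  open ≡-Reasoning
  S = sumFrom1 m (λ i → + (suc m C i) * x ^ i)
  lemma : ∀ s y → 1ℤ + (s + 1ℤ * y) - y + -1ℤ ≡ s
  lemma = solve-∀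

powerSum-binomial : ∀ n m → sumFrom1 m (λ i → + (suc m C i) * powerSum n i) ≡ (+ suc n) ^ suc m - + suc n
powerSum-binomial n m = begin
  sumFrom1 m (λ i → + (suc m C i) * powerSum n i)
    ≡⟨ sumFrom1-cong m (λ i → sumFrom1-*ˡ n (+ (suc m C i)) _) ⟨
  sumFrom1 m (λ i → sumFrom1 n (λ a → + (suc m C i) * (+ a) ^ i))
    ≡⟨ sumFrom1-swap m n _ ⟩
  sumFrom1 n (λ a → sumFrom1 m (λ i → + (suc m C i) * (+ a) ^ i))
    ≡⟨ sumFrom1-cong n (λ a → binomial-tail m (+ a)) ⟩
  sumFrom1 n (λ a → (pow (suc a) - pow a) + -1ℤ)
    ≡⟨ sumFrom1-+ n (λ a → pow (suc a) - pow a) (λ _ → -1ℤ) ⟩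
  sumFrom1 n (λ a → pow (suc a) - pow a) + sumFrom1 n (λ _ → -1ℤ)
    ≡⟨ cong₂ _+_ (sumFrom1-telescope n pow) (sumFrom1-const n -1ℤ) ⟩
  (pow (suc n) - 1ℤ ^ suc m) + + n * -1ℤ
    ≡⟨ cong (λ u → (pow (suc n) - u) + + n * -1ℤ) (ℤ.^-zeroˡ (suc m)) ⟩
  (pow (suc n) - 1ℤ) + + n * -1ℤ
    ≡⟨ lemma (pow (suc n)) (+ n) ⟩
  pow (suc n) - (1ℤ + + n)
    ∎
  where
  open ≡-Reasoning
  pow : ℕ → ℤ
  pow a = (+ a) ^ suc m
  lemma : ∀ x n → (x - 1ℤ) + n * -1ℤ ≡ x - (1ℤ + n)
  lemma = solve-∀

module _ {n : ℕ} (pr : Prime (suc n)) where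

  powerSum-vanishes : ∀ e → 1 ≤ e → e < n → powerSum n e ≈ 0ℤ [mod suc n ]
  powerSum-vanishes = <-rec _ step
    where
    step : ∀ e → (∀ {i} → i < e → 1 ≤ i → i < n → powerSum n i ≈ 0ℤ [mod suc n ]) →
           1 ≤ e → e < n → powerSum n e ≈ 0ℤ [mod suc n ]
    step e below 1≤e e<n = prime-*-cancelˡ-mod pr (small≉0 (s≤s z≤n) (s≤s e<n)) (begin
      + suc e * powerSum n e                             ≡⟨ cong (λ c → + c * powerSum n e) ([1+n]Cn≡1+n e) ⟨
      + (suc e C e) * powerSum n e                       ≈⟨ sumFrom1-single-mod e 1≤e ℕ.≤-refl lower-terms ⟨
      sumFrom1 e (λ i → + (suc e C i) * powerSum n i)    ≡⟨ powerSum-binomial n e ⟩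
      (+ suc n) ^ suc e - + suc n                        ≈⟨ +-cong-mod (*-zeroˡ-mod ((+ suc n) ^ e) modulus≈0)
                                                                       (-‿cong-mod modulus≈0) ⟩
      0ℤ                                                 ≡⟨ ℤ.*-zeroʳ (+ suc e) ⟨
      + suc e * 0ℤ                                       ∎)
      where
      open ModReasoning (suc n)
      lower-terms : ∀ i → 1 ≤ i → i ≤ e → i ≢ e → + (suc e C i) * powerSum n i ≈ 0ℤ [mod suc n ]
      lower-terms i 1≤i i≤e i≢e = mod-trans (*-congˡ-mod (+ (suc e C i)) (below i<e 1≤i (ℕ.<-trans i<e e<n)))
                                            (≡⇒≈[mod] (ℤ.*-zeroʳ (+ (suc e C i))))
        where i<e = ℕ.≤∧≢⇒< i≤e i≢e

  powerSum-pred : powerSum n n ≈ -1ℤ [mod suc n ]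
  powerSum-pred = begin
    powerSum n n             ≈⟨ sumFrom1-cong-mod n (λ a 1≤a a≤n → fermat-unit pr (small≉0 1≤a (s≤s a≤n))) ⟩
    sumFrom1 n (λ _ → 1ℤ)    ≡⟨ trans (sumFrom1-const n 1ℤ) (ℤ.*-identityʳ (+ n)) ⟩
    + n                      ≈⟨ pred≈-1 ⟩
    -1ℤ                      ∎
    where open ModReasoning (suc n)

  powerSum-period : ∀ r → powerSum n (n ℕ.+ r) ≈ powerSum n r [mod suc n ]
  powerSum-period r = sumFrom1-cong-mod n λ a 1≤a a≤n → begin
    (+ a) ^ (n ℕ.+ r)        ≡⟨ ℤ.^-distribˡ-+-* (+ a) n r ⟩
    (+ a) ^ n * (+ a) ^ r    ≈⟨ *-congʳ-mod ((+ a) ^ r) (fermat-unit pr (small≉0 1≤a (s≤s a≤n))) ⟩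
    1ℤ * (+ a) ^ r           ≡⟨ ℤ.*-identityˡ ((+ a) ^ r) ⟩
    (+ a) ^ r                ∎
    where open ModReasoning (suc n)

  powerSum-off-period : ∀ e → 1 ≤ e → e < n ℕ.+ n → e ≢ n → powerSum n e ≈ 0ℤ [mod suc n ]
  powerSum-off-period e 1≤e e<2n e≢n with ℕ.<-cmp e n
  ... | tri< e<n _ _ = powerSum-vanishes e 1≤e e<n
  ... | tri≈ _ e≡n _ = contradiction e≡n e≢n
  ... | tri> _ _ n<e = begin
    powerSum n e                   ≡⟨ cong (powerSum n) (ℕ.m+[n∸m]≡n (ℕ.<⇒≤ n<e)) ⟨
    powerSum n (n ℕ.+ (e ℕ.∸ n))   ≈⟨ powerSum-period (e ℕ.∸ n) ⟩
    powerSum n (e ℕ.∸ n)           ≈⟨ powerSum-vanishes (e ℕ.∸ n) (ℕ.m<n⇒0<n∸m n<e) e∸n<n ⟩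
    0ℤ                             ∎
    where
    open ModReasoning (suc n)
    e∸n<n : e ℕ.∸ n < n
    e∸n<n = ℕ.+-cancelˡ-< n (e ℕ.∸ n) n (subst (_< n ℕ.+ n) (sym (ℕ.m+[n∸m]≡n (ℕ.<⇒≤ n<e))) e<2n)

-- Recovering coefficients divisible by p from values modulo p²

evalPoly : ℕ → (ℕ → ℤ) → ℤ → ℤ
evalPoly n c x = sumFrom1 n (λ j → c j * x ^ j)

module _ {n : ℕ} (pr : Prime (suc n)) (c : ℕ → ℤ) (c≈0 : ∀ j → 1 ≤ j → j ≤ n → c j ≈ 0ℤ [mod suc n ]) where

  coefficient-extraction : ∀ k e → 1 ≤ k → k ℕ.+ e ≡ n →
                           sumFrom1 n (λ a → (+ a) ^ e * evalPoly n c (+ a)) ≈ - c k [mod suc n ℕ.* suc n ]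
  coefficient-extraction k e 1≤k k+e≡n = begin
    sumFrom1 n (λ a → (+ a) ^ e * evalPoly n c (+ a))
      ≡⟨ sumFrom1-cong n (λ a → sym (sumFrom1-*ˡ n ((+ a) ^ e) _)) ⟩
    sumFrom1 n (λ a → sumFrom1 n (λ j → (+ a) ^ e * (c j * (+ a) ^ j)))
      ≡⟨ sumFrom1-cong n (λ a → sumFrom1-cong n (regroup a)) ⟩
    sumFrom1 n (λ a → sumFrom1 n (λ j → c j * (+ a) ^ (j ℕ.+ e)))
      ≡⟨ sumFrom1-swap n n _ ⟩
    sumFrom1 n (λ j → sumFrom1 n (λ a → c j * (+ a) ^ (j ℕ.+ e)))
      ≡⟨ sumFrom1-cong n (λ j → sumFrom1-*ˡ n (c j) _) ⟩
    sumFrom1 n (λ j → c j * powerSum n (j ℕ.+ e))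
      ≈⟨ sumFrom1-single-mod n 1≤k k≤n off-diagonal ⟩
    c k * powerSum n (k ℕ.+ e)
      ≈⟨ *-cong-mod-square (c≈0 k 1≤k k≤n) diagonal ⟩
    c k * -1ℤ
      ≡⟨ trans (ℤ.*-comm (c k) -1ℤ) (ℤ.-1*i≡-i (c k)) ⟩
    - c k
      ∎
    where
    open ModReasoning (suc n ℕ.* suc n)
    k≤n : k ≤ n
    k≤n = subst (k ≤_) k+e≡n (ℕ.m≤m+n k e)
    e<n : e < n
    e<n = subst (e <_) k+e≡n (ℕ.m<n+m e 1≤k)
    lemma : ∀ A c B → A * (c * B) ≡ c * (B * A)
    lemma = solve-∀
    regroup : ∀ a j → (+ a) ^ e * (c j * (+ a) ^ j) ≡ c j * (+ a) ^ (j ℕ.+ e)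
    regroup a j = trans (lemma ((+ a) ^ e) (c j) ((+ a) ^ j))
                        (cong (c j *_) (sym (ℤ.^-distribˡ-+-* (+ a) j e)))
    diagonal : powerSum n (k ℕ.+ e) ≈ -1ℤ [mod suc n ]
    diagonal = subst (λ i → powerSum n i ≈ -1ℤ [mod suc n ]) (sym k+e≡n) (powerSum-pred pr)
    off-diagonal : ∀ j → 1 ≤ j → j ≤ n → j ≢ k → c j * powerSum n (j ℕ.+ e) ≈ 0ℤ [mod suc n ℕ.* suc n ]
    off-diagonal j 1≤j j≤n j≢k =
      mod-trans (*-cong-mod-square (c≈0 j 1≤j j≤n)
                  (powerSum-off-period pr (j ℕ.+ e) (ℕ.≤-trans 1≤j (ℕ.m≤m+n j e)) (ℕ.+-mono-≤-< j≤n e<n)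
                    λ j+e≡n → j≢k (ℕ.+-cancelʳ-≡ e j k (trans j+e≡n (sym k+e≡n)))))
                (≡⇒≈[mod] (ℤ.*-zeroʳ (c j)))

  coefficient-from-ends : 2 ≤ n → (∀ a → 2 ≤ a → a < n → evalPoly n c (+ a) ≈ 0ℤ [mod suc n ℕ.* suc n ]) →
                          ∀ k h → 1 ≤ k → k ℕ.+ 2 ℕ.* h ≡ n →
                          c k ≈ - (evalPoly n c 1ℤ + evalPoly n c (+ n)) [mod suc n ℕ.* suc n ]
  coefficient-from-ends 2≤n interior≈0 k h 1≤k k+e≡n = begin
    c k                                            ≡⟨ ℤ.neg-involutive (c k) ⟨
    - - c k                                        ≈⟨ -‿cong-mod (coefficient-extraction k e 1≤k k+e≡n) ⟨
    - sumFrom1 n (λ a → (+ a) ^ e * P (+ a))       ≈⟨ -‿cong-mod (sumFrom1-ends-mod n 2≤n interior) ⟩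
    - ((+ 1) ^ e * P 1ℤ + (+ n) ^ e * P (+ n))     ≈⟨ -‿cong-mod (+-cong-mod (≡⇒≈[mod] first) last) ⟩
    - (P 1ℤ + P (+ n))                             ∎
    where
    open ModReasoning (suc n ℕ.* suc n)
    e = 2 ℕ.* h
    P = evalPoly n c
    interior : ∀ a → 2 ≤ a → a < n → (+ a) ^ e * P (+ a) ≈ 0ℤ [mod suc n ℕ.* suc n ]
    interior a 2≤a a<n =
      mod-trans (*-congˡ-mod ((+ a) ^ e) (interior≈0 a 2≤a a<n)) (≡⇒≈[mod] (ℤ.*-zeroʳ ((+ a) ^ e)))
    first : (+ 1) ^ e * P 1ℤ ≡ P 1ℤ
    first = trans (cong (_* P 1ℤ) (ℤ.^-zeroˡ e)) (ℤ.*-identityˡ (P 1ℤ))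
    P[n]≈0 : P (+ n) ≈ 0ℤ [mod suc n ]
    P[n]≈0 = sumFrom1-zero-mod n (λ j 1≤j j≤n → *-zeroˡ-mod ((+ n) ^ j) (c≈0 j 1≤j j≤n))
    n^e≈1 : (+ n) ^ e ≈ 1ℤ [mod suc n ]
    n^e≈1 = mod-trans (^-cong-mod pred≈-1 e) (≡⇒≈[mod] (-1^even h))
    last : (+ n) ^ e * P (+ n) ≈ P (+ n) [mod suc n ℕ.* suc n ]
    last = begin
      (+ n) ^ e * P (+ n)       ≡⟨ ℤ.*-comm ((+ n) ^ e) (P (+ n)) ⟩
      P (+ n) * (+ n) ^ e       ≈⟨ *-cong-mod-square P[n]≈0 n^e≈1 ⟩
      P (+ n) * 1ℤ              ≡⟨ ℤ.*-identityʳ (P (+ n)) ⟩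
      P (+ n)                   ∎

-- The sum at the Teichmüller representatives k^p

module TeichmüllerSum {n : ℕ} (pr : Prime (suc n)) where

  private
    p : ℕ
    p = suc n
    instance _ = prime⇒nonZero pr

  teichmüller : ℕ → ℤ
  teichmüller k = (+ k) ^ p

  -- theSum p pr ω α unfolds to evalPoly n (λ k → (-1)^k (C(p,k)/p) ω k) α,
  -- so theSum p pr teichmüller α is evalPoly n coeff α.
  coeff coeff+1 : ℕ → ℤ
  coeff k = (-1ℤ ^ k) * (+ binomOverP p pr k) * teichmüller k
  coeff+1 k = 1ℤ + coeff k

  [1+j]*binomOverP≡nCj : j < n → suc j ℕ.* binomOverP p pr (suc j) ≡ n C j
  [1+j]*binomOverP≡nCj {j} j<n = ℕ.*-cancelˡ-≡ _ _ p (begin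
    p ℕ.* (suc j ℕ.* binomOverP p pr (suc j))
      ≡⟨ x∙yz≈y∙xz p (suc j) (binomOverP p pr (suc j)) ⟩
    suc j ℕ.* (p ℕ.* binomOverP p pr (suc j))
      ≡⟨ cong (suc j ℕ.*_) (ℕ.m*[n/m]≡n (prime∣[p]C[k] pr (s≤s z≤n) (s≤s j<n))) ⟩
    suc j ℕ.* (p C suc j)
      ≡⟨ [1+k]*[1+n]C[1+k]≡[1+n]*nCk n j ⟩
    p ℕ.* (n C j)
      ∎)
    where open ≡-Reasoning

  nCj≈-1^j : j ≤ n → + (n C j) ≈ -1ℤ ^ j [mod p ]
  nCj≈-1^j {zero}  _   = mod-refl
  nCj≈-1^j {suc j} j<n = begin
    + (n C suc j)                              ≡⟨ lemma (+ (n C j)) (+ (n C suc j)) ⟩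
    (+ (n C j) + + (n C suc j)) - + (n C j)    ≡⟨ cong (λ c → + c - + (n C j)) (nCk+nC[k+1]≡[n+1]C[k+1] n j) ⟩
    + (p C suc j) - + (n C j)                  ≈⟨ +-cong-mod ([p]C[k]≈0 pr (s≤s z≤n) (s≤s j<n))
                                                             (-‿cong-mod (nCj≈-1^j (ℕ.<⇒≤ j<n))) ⟩
    0ℤ - -1ℤ ^ j                               ≡⟨ lemma′ (-1ℤ ^ j) ⟩
    -1ℤ ^ suc j                                ∎
    where
    open ModReasoning p
    lemma : ∀ a b → b ≡ (a + b) - a
    lemma = solve-∀
    lemma′ : ∀ x → 0ℤ - x ≡ -1ℤ * x
    lemma′ = solve-∀

  coeff≈-1 : 1 ≤ k → k ≤ n → coeff k ≈ -1ℤ [mod p ]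
  coeff≈-1 {suc j} _ j<n = begin
    s * + B * teichmüller (suc j)     ≈⟨ *-congˡ-mod (s * + B) (fermat pr (suc j)) ⟩
    s * + B * + suc j                 ≡⟨ lemma s (+ B) (+ suc j) ⟩
    s * (+ suc j * + B)               ≡⟨ cong (s *_) (trans (sym (ℤ.pos-* (suc j) B))
                                                            (cong +_ ([1+j]*binomOverP≡nCj j<n))) ⟩
    s * + (n C j)                     ≈⟨ *-congˡ-mod s (nCj≈-1^j (ℕ.<⇒≤ j<n)) ⟩
    -1ℤ * -1ℤ ^ j * -1ℤ ^ j           ≡⟨ ℤ.*-assoc -1ℤ (-1ℤ ^ j) (-1ℤ ^ j) ⟩
    -1ℤ * (-1ℤ ^ j * -1ℤ ^ j)         ≡⟨ cong (-1ℤ *_) (-1^j*-1^j≡1 j) ⟩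
    -1ℤ                               ∎
    where
    open ModReasoning p
    s = -1ℤ ^ suc j
    B = binomOverP p pr (suc j)
    lemma : ∀ s b k → s * b * k ≡ s * (k * b)
    lemma = solve-∀

  coeff+1≈0 : 1 ≤ k → k ≤ n → coeff+1 k ≈ 0ℤ [mod p ]
  coeff+1≈0 1≤k k≤n = +-congˡ-mod 1ℤ (coeff≈-1 1≤k k≤n)

  teichmüller-root : 1 ≤ k → k ≤ n → teichmüller k ^ n ≈ 1ℤ [mod p ℕ.* p ]
  teichmüller-root {k} 1≤k k≤n =
    root-of-unity-lift {x = + k} {k = n} (fermat-unit pr (small≉0 1≤k (s≤s k≤n)))

  teichmüller≉1 : 2 ≤ k → k ≤ n → ¬ (teichmüller k ≈ 1ℤ [mod p ])
  teichmüller≉1 {k} 2≤k k≤n t≈1 = small≉1 2≤k (s≤s k≤n) (mod-trans (mod-sym (fermat pr k)) t≈1)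

  teichmüller≉-1 : k < n → ¬ (teichmüller k ≈ -1ℤ [mod p ])
  teichmüller≉-1 {k} k<n t≈-1 = small≉-1 (s≤s k<n) (mod-trans (mod-sym (fermat pr k)) t≈-1)

  teichmüller-unique : ∀ {ω} → IsTeichmüllerModP² p ω → 1 ≤ k → k ≤ n → ω k ≈ teichmüller k [mod p ℕ.* p ]
  teichmüller-unique {k} isTeichmüller 1≤k k≤n with isTeichmüller k 1≤k (s≤s k≤n)
  ... | ω[k]∈μ , ω[k]≡k = root-of-unity-unique (≈mod ω[k]∈μ) (teichmüller-root 1≤k k≤n)
                                               (mod-trans (≈mod ω[k]≡k) (mod-sym (fermat pr k)))

  theSum≈teichmüller : ∀ {ω} → IsTeichmüllerModP² p ω → ∀ α →
                       theSum p pr ω α ≈ theSum p pr teichmüller α [mod p ℕ.* p ]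
  theSum≈teichmüller isTeichmüller α = sumFrom1-cong-mod n λ k 1≤k k≤n →
    *-congʳ-mod (α ^ k) (*-congˡ-mod ((-1ℤ ^ k) * + binomOverP p pr k)
                                     (teichmüller-unique isTeichmüller 1≤k k≤n))

  evalPoly-coeff+1≈theSum : ∀ {a} → 2 ≤ a → a ≤ n →
                            evalPoly n coeff+1 (+ a) ≈ theSum p pr teichmüller (teichmüller a) [mod p ℕ.* p ]
  evalPoly-coeff+1≈theSum {a} 2≤a a≤n = begin
    evalPoly n coeff+1 (+ a)
      ≈⟨ sumFrom1-cong-mod n (λ j 1≤j j≤n → *-cong-mod-square (coeff+1≈0 1≤j j≤n) (^-cong-mod a≈α j)) ⟩
    evalPoly n coeff+1 α
      ≡⟨ sumFrom1-cong n (λ j → lemma (coeff j) (α ^ j)) ⟩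
    sumFrom1 n (λ j → α ^ j + coeff j * α ^ j)
      ≡⟨ sumFrom1-+ n (α ^_) (λ j → coeff j * α ^ j) ⟩
    sumFrom1 n (α ^_) + evalPoly n coeff α
      ≈⟨ +-congʳ-mod (evalPoly n coeff α) geometric≈0 ⟩
    0ℤ + evalPoly n coeff α
      ≡⟨ ℤ.+-identityˡ (evalPoly n coeff α) ⟩
    evalPoly n coeff α
      ∎
    where
    open ModReasoning (p ℕ.* p)
    α = teichmüller a
    a≈α : + a ≈ α [mod p ]
    a≈α = mod-sym (fermat pr a)
    geometric≈0 : sumFrom1 n (α ^_) ≈ 0ℤ [mod p ℕ.* p ]
    geometric≈0 = geometric-sum-vanishes pr (teichmüller-root (ℕ.≤-trans (s≤s z≤n) 2≤a) a≤n)
                                            (teichmüller≉1 2≤a a≤n)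
    lemma : ∀ c y → (1ℤ + c) * y ≡ y + c * y
    lemma = solve-∀

private
  parity : ∀ m → Σ ℕ λ h → m ≡ 2 ℕ.* h ⊎ m ≡ suc (2 ℕ.* h)
  parity zero    = 0 , inj₁ refl
  parity (suc m) with parity m
  ... | h , inj₁ m≡2h   = h , inj₂ (cong suc m≡2h)
  ... | h , inj₂ m≡1+2h = suc h , inj₁ (trans (cong suc m≡1+2h) (cong suc (sym (ℕ.+-suc h (h ℕ.+ 0)))))

prime≥5-shape : ∀ {p} → Prime p → 5 ≤ p → Σ ℕ λ g → p ≡ suc (2 ℕ.* suc (suc g))
prime≥5-shape {p} pr 5≤p with parity p
... | h             , inj₁ refl =
  contradiction (composite 2<2h (ℕ.divides h (ℕ.*-comm 2 h))) (prime⇒¬composite pr)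
  where
  2<2h : 2 < 2 ℕ.* h
  2<2h = ℕ.<-≤-trans (s≤s (s≤s (s≤s z≤n))) 5≤p
... | zero          , inj₂ refl = contradiction 5≤p λ { (s≤s ()) }
... | suc zero      , inj₂ refl = contradiction 5≤p λ { (s≤s (s≤s (s≤s ()))) }
... | suc (suc g)   , inj₂ refl = g , refl

module _ (g : ℕ) (pr : Prime (suc (2 ℕ.* suc (suc g)))) where

  private
    n n-2 p : ℕ
    n = 2 ℕ.* suc (suc g)
    n-2 = ℕ.pred (ℕ.pred n)
    p = suc n

  open TeichmüllerSum pr

  4≤n : 4 ≤ n
  4≤n = ℕ.*-monoʳ-≤ 2 (s≤s (s≤s z≤n))

  binomOverP[n]≡1 : binomOverP p pr n ≡ 1
  binomOverP[n]≡1 = ℕ.*-cancelˡ-≡ _ 1 n (begin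
    n ℕ.* binomOverP p pr n    ≡⟨ [1+j]*binomOverP≡nCj (ℕ.n<1+n (suc n-2)) ⟩
    n C suc n-2                ≡⟨ [1+n]Cn≡1+n (suc n-2) ⟩
    n                          ≡⟨ ℕ.*-identityʳ n ⟨
    n ℕ.* 1                    ∎)
    where open ≡-Reasoning

  coeff+1[n]≈0 : coeff+1 n ≈ 0ℤ [mod p ℕ.* p ]
  coeff+1[n]≈0 = +-congˡ-mod 1ℤ (begin
    (-1ℤ ^ n) * + binomOverP p pr n * (+ n) ^ p
      ≡⟨ cong₂ (λ s c → s * + c * (+ n) ^ p) (-1^even (suc (suc g))) binomOverP[n]≡1 ⟩
    1ℤ * 1ℤ * (+ n) ^ p
      ≡⟨ ℤ.*-identityˡ ((+ n) ^ p) ⟩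
    (+ n) ^ p
      ≈⟨ ^-cong-mod-square pred≈-1 ⟩
    -1ℤ * -1ℤ ^ n
      ≡⟨ cong (-1ℤ *_) (-1^even (suc (suc g))) ⟩
    -1ℤ
      ∎)
    where open ModReasoning (p ℕ.* p)

  4^p≡2^p*2^p : (+ 4) ^ p ≡ (+ 2) ^ p * (+ 2) ^ p
  4^p≡2^p*2^p = begin
    ((+ 2) ^ 2) ^ p      ≡⟨ ℤ.^-*-assoc (+ 2) 2 p ⟩
    (+ 2) ^ (2 ℕ.* p)    ≡⟨ cong ((+ 2) ^_) (ℕ.*-comm 2 p) ⟩
    (+ 2) ^ (p ℕ.* 2)    ≡⟨ ℤ.^-*-assoc (+ 2) p 2 ⟨
    U * (U * 1ℤ)         ≡⟨ cong (U *_) (ℤ.*-identityʳ U) ⟩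
    U * U                ∎
    where
    open ≡-Reasoning
    U = (+ 2) ^ p

  2*binomOverP[2]≡n : + 2 * + binomOverP p pr 2 ≡ + n
  2*binomOverP[2]≡n = begin
    + 2 * + binomOverP p pr 2       ≡⟨ ℤ.pos-* 2 (binomOverP p pr 2) ⟨
    + (2 ℕ.* binomOverP p pr 2)     ≡⟨ cong +_ ([1+j]*binomOverP≡nCj (ℕ.≤-trans (s≤s (s≤s z≤n)) 4≤n)) ⟩
    + (n C 1)                       ≡⟨ cong +_ (nC1≡n n) ⟩
    + n                             ∎
    where open ≡-Reasoning

  24*binomOverP[4]≡n[n-1][n-2] : + 24 * + binomOverP p pr 4 ≡ + n * + suc n-2 * + n-2
  24*binomOverP[4]≡n[n-1][n-2] = begin
    + 24 * + binomOverP p pr 4            ≡⟨ ℤ.pos-* 24 (binomOverP p pr 4) ⟨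
    + (24 ℕ.* binomOverP p pr 4)          ≡⟨ cong +_ (ℕ.*-assoc 6 4 (binomOverP p pr 4)) ⟩
    + (6 ℕ.* (4 ℕ.* binomOverP p pr 4))   ≡⟨ cong (λ c → + (6 ℕ.* c)) ([1+j]*binomOverP≡nCj 4≤n) ⟩
    + (6 ℕ.* (n C 3))                     ≡⟨ cong +_ (6*[2+m]C3 n-2) ⟩
    + (n ℕ.* suc n-2 ℕ.* n-2)             ≡⟨ ℤ.pos-* (n ℕ.* suc n-2) n-2 ⟩
    + (n ℕ.* suc n-2) * + n-2             ≡⟨ cong (_* + n-2) (ℤ.pos-* n (suc n-2)) ⟩
    + n * + suc n-2 * + n-2               ∎
    where open ≡-Reasoning

  -- t is the Fermat quotient (2^p - 2)/p. After substituting 24 B₄ = (p-1)(p-2)(p-3),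
  -- 2 B₂ = p - 1 and 2^p = 2 + t p, all terms involving t cancel modulo p²;
  -- K is the exact quotient of what remains.
  key-congruence : + 24 * coeff+1 4 - + 48 * coeff+1 2 ≈ - (+ 4 * + p) [mod p ℕ.* p ]
  key-congruence = begin
    + 24 * coeff+1 4 - + 48 * coeff+1 2
      ≡⟨ cong (λ u → + 24 * (1ℤ + 1ℤ * B₄ * u) - + 48 * coeff+1 2) 4^p≡2^p*2^p ⟩
    + 24 * (1ℤ + 1ℤ * B₄ * (U * U)) - + 48 * (1ℤ + 1ℤ * B₂ * U)
      ≡⟨ lemma₁ B₄ B₂ U ⟩
    (+ 24 * B₄) * (U * U) - + 24 * ((+ 2 * B₂) * U) - + 24
      ≡⟨ cong₂ (λ x y → x * (U * U) - + 24 * (y * U) - + 24) 24*binomOverP[4]≡n[n-1][n-2] 2*binomOverP[2]≡n ⟩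
    + n * + suc n-2 * + n-2 * (U * U) - + 24 * (+ n * U) - + 24
      ≡⟨ cong (λ u → + n * + suc n-2 * + n-2 * (u * u) - + 24 * (+ n * u) - + 24) U≡2+tp ⟩
    + n * + suc n-2 * + n-2 * ((+ 2 + t * + p) * (+ 2 + t * + p)) - + 24 * (+ n * (+ 2 + t * + p)) - + 24
      ≡⟨ lemma₂ (+ n-2) t ⟩
    - (+ 4 * + p) + K * (+ p * + p)
      ≈⟨ +-congˡ-mod (- (+ 4 * + p)) K*p²≈0 ⟩
    - (+ 4 * + p) + 0ℤ
      ≡⟨ ℤ.+-identityʳ (- (+ 4 * + p)) ⟩
    - (+ 4 * + p)
      ∎
    where
    open ModReasoning (p ℕ.* p)
    B₂ B₄ U t K : ℤ
    B₂ = + binomOverP p pr 2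
    B₄ = + binomOverP p pr 4
    U = (+ 2) ^ p
    t = proj₁ (≈[mod]-witness (fermat pr 2))
    K = + 4 * + p - + 24 + + 20 * t - + 24 * t * + p + + 4 * t * + p * + p - + 6 * t * t
        + + 11 * t * t * + p - + 6 * t * t * + p * + p + t * t * + p * + p * + p
    U≡2+tp : U ≡ + 2 + t * + p
    U≡2+tp = proj₂ (≈[mod]-witness (fermat pr 2))
    K*p²≈0 : K * (+ p * + p) ≈ 0ℤ [mod p ℕ.* p ]
    K*p²≈0 = begin
      K * (+ p * + p)      ≡⟨ cong (K *_) (ℤ.pos-* p p) ⟨
      K * + (p ℕ.* p)      ≈⟨ *-congˡ-mod K modulus≈0 ⟩
      K * 0ℤ               ≡⟨ ℤ.*-zeroʳ K ⟩
      0ℤ                   ∎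
    lemma₁ : ∀ B₄ B₂ U → + 24 * (1ℤ + 1ℤ * B₄ * (U * U)) - + 48 * (1ℤ + 1ℤ * B₂ * U) ≡
                         (+ 24 * B₄) * (U * U) - + 24 * ((+ 2 * B₂) * U) - + 24
    lemma₁ = solve-∀
    lemma₂ : ∀ M t → (+ 2 + M) * (1ℤ + M) * M * ((+ 2 + t * (+ 3 + M)) * (+ 2 + t * (+ 3 + M)))
                     - + 24 * ((+ 2 + M) * (+ 2 + t * (+ 3 + M))) - + 24
                   ≡ - (+ 4 * (+ 3 + M))
                     + (+ 4 * (+ 3 + M) - + 24 + + 20 * t - + 24 * t * (+ 3 + M)
                        + + 4 * t * (+ 3 + M) * (+ 3 + M) - + 6 * t * t + + 11 * t * t * (+ 3 + M)
                        - + 6 * t * t * (+ 3 + M) * (+ 3 + M) + t * t * (+ 3 + M) * (+ 3 + M) * (+ 3 + M))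
                       * ((+ 3 + M) * (+ 3 + M))
    lemma₂ = solve-∀

  coeff+1[2]≈0⇒coeff+1[4]≉0 : coeff+1 2 ≈ 0ℤ [mod p ℕ.* p ] → ¬ (coeff+1 4 ≈ 0ℤ [mod p ℕ.* p ])
  coeff+1[2]≈0⇒coeff+1[4]≉0 c₂≈0 c₄≈0 = contradiction (ℕ.∣⇒≤ p∣4) (ℕ.<⇒≱ (s≤s 4≤n))
    where
    open ModReasoning (p ℕ.* p)
    4p≈0 : + 4 * + p ≈ 0ℤ [mod p ℕ.* p ]
    4p≈0 = begin
      + 4 * + p                                  ≡⟨ ℤ.neg-involutive (+ 4 * + p) ⟨
      - - (+ 4 * + p)                            ≈⟨ -‿cong-mod key-congruence ⟨
      - (+ 24 * coeff+1 4 - + 48 * coeff+1 2)    ≈⟨ -‿cong-mod lhs≈0 ⟩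
      0ℤ                                         ∎
      where
      lhs≈0 : + 24 * coeff+1 4 - + 48 * coeff+1 2 ≈ 0ℤ [mod p ℕ.* p ]
      lhs≈0 = +-cong-mod (*-congˡ-mod (+ 24) c₄≈0) (-‿cong-mod (*-congˡ-mod (+ 48) c₂≈0))
    p∣4 : p ℕ.∣ 4
    p∣4 = ℕ.*-cancelʳ-∣ p (subst (p ℕ.* p ℕ.∣_) (ℤ.abs-* (+ 4) (+ p)) (≈0⇒∣ 4p≈0))

  ¬all-interior-roots : ¬ (∀ a → 2 ≤ a → a < n → theSum p pr teichmüller (teichmüller a) ≈ 0ℤ [mod p ℕ.* p ])
  ¬all-interior-roots all≈0 =
    coeff+1[2]≈0⇒coeff+1[4]≉0 (even-coeff+1≈0 2 (suc g) (s≤s z≤n) (sym (ℕ.*-distribˡ-+ 2 1 (suc g))))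
                              (even-coeff+1≈0 4 g (s≤s z≤n) (sym (ℕ.*-distribˡ-+ 2 2 g)))
    where
    interior≈0 : ∀ a → 2 ≤ a → a < n → evalPoly n coeff+1 (+ a) ≈ 0ℤ [mod p ℕ.* p ]
    interior≈0 a 2≤a a<n = mod-trans (evalPoly-coeff+1≈theSum 2≤a (ℕ.<⇒≤ a<n)) (all≈0 a 2≤a a<n)
    from-ends : ∀ k h → 1 ≤ k → k ℕ.+ 2 ℕ.* h ≡ n →
                coeff+1 k ≈ - (evalPoly n coeff+1 1ℤ + evalPoly n coeff+1 (+ n)) [mod p ℕ.* p ]
    from-ends = coefficient-from-ends pr coeff+1 (λ _ → coeff+1≈0)
                                      (ℕ.≤-trans (s≤s (s≤s z≤n)) 4≤n) interior≈0
    even-coeff+1≈0 : ∀ k h → 1 ≤ k → k ℕ.+ 2 ℕ.* h ≡ n → coeff+1 k ≈ 0ℤ [mod p ℕ.* p ]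
    even-coeff+1≈0 k h 1≤k k+2h≡n =
      mod-trans (from-ends k h 1≤k k+2h≡n)
                (mod-trans (mod-sym (from-ends n 0 (s≤s z≤n) (ℕ.+-identityʳ n))) coeff+1[n]≈0)

  private
    root? : ∀ a → Dec (theSum p pr teichmüller (teichmüller a) ≈ 0ℤ [mod p ℕ.* p ])
    root? a = theSum p pr teichmüller (teichmüller a) ≈? 0ℤ [mod p ℕ.* p ]

  interior-nonroot : Σ ℕ λ a → 2 ≤ a × a < n × ¬ (theSum p pr teichmüller (teichmüller a) ≈ 0ℤ [mod p ℕ.* p ])
  interior-nonroot with ℕ.anyUpTo? (λ a → (2 ℕ.≤? a) ×-dec ¬? (root? a)) n
  ... | yes (a , a<n , 2≤a , a≉root) = a , 2≤a , a<n , a≉root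
  ... | no ∄ = contradiction all-roots ¬all-interior-roots
    where
    all-roots : ∀ a → 2 ≤ a → a < _ → theSum _ pr teichmüller (teichmüller a) ≈ 0ℤ [mod _ ]
    all-roots a 2≤a a<n = decidable-stable (root? a) λ a≉root → ∄ (a , a<n , 2≤a , a≉root)

lemma1p17 : (p : ℕ) → (pr : Prime p) → 5 ≤ p →
    Σ ℤ (λ α → InMuModP² p α × ¬ (α ≡ 1ℤ [mod (p ℕ.* p) ]) × ¬ (α ≡ -1ℤ [mod (p ℕ.* p) ])
      × ((ω : ℕ → ℤ) → IsTeichmüllerModP² p ω → ¬ (theSum p pr ω α ≡ 0ℤ [mod (p ℕ.* p) ])))
lemma1p17 p pr 5≤p with prime≥5-shape pr 5≤p
... | g , refl with interior-nonroot g pr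
...   | a , 2≤a , a<n , a≉root =
  teichmüller a
  , ≡mod (teichmüller-root (ℕ.≤-trans (s≤s z≤n) 2≤a) (ℕ.<⇒≤ a<n))
  , teichmüller≉1 2≤a (ℕ.<⇒≤ a<n) ∘ mod-square⇒mod ∘ ≈mod
  , teichmüller≉-1 a<n ∘ mod-square⇒mod ∘ ≈mod
  , λ ω isTeichmüller sum≡0 →
      a≉root (mod-trans (mod-sym (theSum≈teichmüller isTeichmüller (teichmüller a))) (≈mod sum≡0))
  where open TeichmüllerSum pr
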